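{- There exist infinitely many primitive isosceles Heron triangles with two sides being perfect squares.
   Context: A Heron triangle is a (nondegenerate) triangle whose three side lengths are positive integers and whose area is an integer. It is primitive if the greatest common divisor of its three side lengths is $1$. A triangle is isosceles if two of its side lengths are equal. "Two sides being perfect squares" means that (at least) two of its side lengths are squares of integers. -}

module Defs where

open import Data.Nat using (ℕ; _+_; _*_; _∸_; _<_; _>_)
open import Data.Nat.GCD using (gcd)
open import Data.Product using (Σ; ∃; _×_)
open import Data.Sum using (_⊎_)
open import Relation.Binary.PropositionalEquality using (_≡_)

-- Nondegenerate triangle with positive integer sides a b c
-- (strict triangle inequalities; these imply positivity).
IsTriangle : ℕ → ℕ → ℕ → Set
IsTriangle a b c = (a < b + c) × (b < a + c) × (c < a + b)

-- Heron's formula: 16 * Area^2 = (a+b+c)(-a+b+c)(a-b+c)(a+b-c).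
-- Under the triangle inequalities the truncated subtractions are exact.
sixteenAreaSq : ℕ → ℕ → ℕ → ℕ
sixteenAreaSq a b c = (a + b + c) * ((b + c) ∸ a) * ((a + c) ∸ b) * ((a + b) ∸ c)

HasIntegerArea : ℕ → ℕ → ℕ → Set
HasIntegerArea a b c = ∃ λ Δ → 16 * (Δ * Δ) ≡ sixteenAreaSq a b c

IsHeron : ℕ → ℕ → ℕ → Set
IsHeron a b c = IsTriangle a b c × HasIntegerArea a b c

IsPrimitive : ℕ → ℕ → ℕ → Set
IsPrimitive a b c = gcd (gcd a b) c ≡ 1

IsIsosceles : ℕ → ℕ → ℕ → Set
IsIsosceles a b c = (a ≡ b) ⊎ (b ≡ c) ⊎ (a ≡ c)

IsSquare : ℕ → Set
IsSquare n = ∃ λ m → m * m ≡ n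

TwoSidesSquare : ℕ → ℕ → ℕ → Set
TwoSidesSquare a b c =
  (IsSquare a × IsSquare b) ⊎ (IsSquare b × IsSquare c) ⊎ (IsSquare a × IsSquare c)

Good : ℕ → ℕ → ℕ → Set
Good a b c = IsHeron a b c × IsPrimitive a b c × IsIsosceles a b c × TwoSidesSquare a b c

{-# OPTIONS --safe #-}
module Submission where

-- For legs p < q, the isosceles triangle with equal sides p² + q² and base 4pq is two
-- copies of the right triangle (2pq, q² − p², p² + q²) glued along the leg q² − p², so it
-- is Heron with area 2pq(q² − p²).  If (p, q, q + 1) is itself a Pythagorean triple, as
-- (1 + 2k, 2k(1 + k), 2k(1 + k) + 1) is, the equal sides are the square (q + 1)²; and
-- q + 1 is odd, consecutive to q, and satisfies 2(q + 1) = p² + 1, so it is coprime to the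
-- base 4pq and the sides have gcd 1.  Letting k grow gives infinitely many of them.

open import Defs
open import Data.Nat using (ℕ; suc; _+_; _*_; _∸_; _≤_; _<_; _>_; z<s)
open import Data.Nat.Properties
open import Data.Nat.Divisibility using (_∣_; ∣-trans; ∣1⇒≡1; ∣m+n∣m⇒∣n; m∣m*n; n∣m*n)
open import Data.Nat.GCD using (gcd[m,n]∣m)
open import Data.Nat.Coprimality
  using (Coprime; sym; coprime⇒gcd≡1; coprime-divisor; coprime-+; 1-coprimeTo)
open import Data.Nat.Tactic.RingSolver using (solve-∀)
open import Data.Product using (∃; _×_; _,_)
open import Data.Sum using (inj₁)
open import Relation.Binary.PropositionalEquality
  using (_≡_; refl; trans; cong; cong₂; subst)
  renaming (sym to ≡-sym)

coprime-∣ˡ : ∀ {d m n} → d ∣ m → Coprime m n → Coprime d n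
coprime-∣ˡ d∣m coprime (i∣d , i∣n) = coprime (∣-trans i∣d d∣m , i∣n)

coprime-*ʳ : ∀ {m n o} → Coprime m n → Coprime m o → Coprime m (n * o)
coprime-*ʳ m⊥n m⊥o (i∣m , i∣n*o) =
  m⊥o (i∣m , coprime-divisor (coprime-∣ˡ i∣m m⊥n) i∣n*o)

coprime-*ˡ : ∀ {m n o} → Coprime m o → Coprime n o → Coprime (m * n) o
coprime-*ˡ m⊥o n⊥o = sym (coprime-*ʳ (sym m⊥o) (sym n⊥o))

*+1-coprime : ∀ n k → Coprime (n * k + 1) n
*+1-coprime n k (i∣n*k+1 , i∣n) = ∣1⇒≡1 (∣m+n∣m⇒∣n i∣n*k+1 (∣-trans i∣n (m∣m*n k)))

coprime⇒isPrimitive : ∀ {a c} → Coprime a c → IsPrimitive a a c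
coprime⇒isPrimitive {a} a⊥c = coprime⇒gcd≡1 (coprime-∣ˡ (gcd[m,n]∣m a a) a⊥c)

isoscelesHeron : ∀ {p q} → 0 < p → p < q →
                 IsHeron (p * p + q * q) (p * p + q * q) (4 * p * q)
isoscelesHeron {p} z<s p<q with m≤n⇒∃[o]m+o≡n p<q
... | d , refl = (a<a+c , a<a+c , c<a+a) , Δ , area
  where
  q = suc (p + d)
  e = suc d
  a = p * p + q * q
  c = 4 * p * q
  Δ = 2 * p * q * e * (p + q)

  a+a≡2e²+c : ∀ p d → let q = suc (p + d) ; a = p * p + q * q in
              a + a ≡ 2 * (suc d * suc d) + 4 * p * q
  a+a≡2e²+c = solve-∀

  heronIdentity : ∀ p d → let q = suc (p + d) ; a = p * p + q * q ; c = 4 * p * q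
                              Δ = 2 * p * q * suc d * (p + q) in
                  16 * (Δ * Δ) ≡ (a + a + c) * c * c * (2 * (suc d * suc d))
  heronIdentity = solve-∀

  a<a+c : a < a + c
  a<a+c = m<m+n a z<s

  c<a+a : c < a + a
  c<a+a = subst (c <_) (≡-sym (a+a≡2e²+c p d)) (m<n+m c z<s)

  a+a∸c≡2e² : (a + a) ∸ c ≡ 2 * (e * e)
  a+a∸c≡2e² = trans (cong (_∸ c) (a+a≡2e²+c p d)) (m+n∸n≡m _ c)

  area : 16 * (Δ * Δ) ≡ sixteenAreaSq a a c
  area = trans (heronIdentity p d)
    (cong₂ (λ x y → (a + a + c) * x * x * y) (≡-sym (m+n∸m≡n a c)) (≡-sym a+a∸c≡2e²))

consecutive-pythagorean : ∀ {p q} → p * p ≡ 2 * q + 1 → p * p + q * q ≡ (q + 1) * (q + 1)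
consecutive-pythagorean {p} {q} p²≡2q+1 = trans (cong (_+ q * q) p²≡2q+1) (square-suc q)
  where
  square-suc : ∀ q → 2 * q + 1 + q * q ≡ (q + 1) * (q + 1)
  square-suc = solve-∀

hypotenuse-coprime : ∀ {p r} → p * p ≡ 2 * (2 * r) + 1 →
                     Coprime (2 * r + 1) (4 * p * (2 * r))
hypotenuse-coprime {p} {r} p²≡2q+1 = coprime-*ʳ (coprime-*ʳ (coprime-*ʳ m⊥2 m⊥2) m⊥p) m⊥q
  where
  m⊥2 : Coprime (2 * r + 1) 2
  m⊥2 = *+1-coprime 2 r

  m⊥q : Coprime (2 * r + 1) (2 * r)
  m⊥q = coprime-+ (1-coprimeTo (2 * r))

  2m≡p²+1 : 2 * (2 * r + 1) ≡ p * p + 1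
  2m≡p²+1 = trans (*-distribˡ-+ 2 (2 * r) 1)
    (trans (≡-sym (+-assoc (2 * (2 * r)) 1 1)) (cong (_+ 1) (≡-sym p²≡2q+1)))

  m⊥p : Coprime (2 * r + 1) p
  m⊥p = coprime-∣ˡ (n∣m*n 2) (subst (λ x → Coprime x p) (≡-sym 2m≡p²+1) (*+1-coprime p p))

[1+2k]²≡4k[1+k]+1 : ∀ k → (1 + 2 * k) * (1 + 2 * k) ≡ 2 * (2 * (k * (1 + k))) + 1
[1+2k]²≡4k[1+k]+1 = solve-∀

1+2k<2k[1+k] : ∀ j → let k = suc j in 1 + 2 * k < 2 * (k * (1 + k))
1+2k<2k[1+k] j = subst (2 + 2 * suc j ≤_) (≡-sym (gap j)) (m≤m+n _ _)
  where
  gap : ∀ j → let k = suc j in 2 * (k * (1 + k)) ≡ 2 + 2 * k + 2 * (j * (2 + j))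
  gap = solve-∀

theorem1p3 : (N : ℕ) → ∃ λ a → ∃ λ b → ∃ λ c → (a + b + c > N) × Good a b c
theorem1p3 N = a , a , c , N<perimeter , heron , isPrimitive , inj₁ refl , inj₁ (square , square)
  where
  k = suc N
  p = 1 + 2 * k
  r = k * (1 + k)
  q = 2 * r
  m = q + 1
  a = m * m
  c = 4 * p * q

  p²≡2q+1 : p * p ≡ 2 * q + 1
  p²≡2q+1 = [1+2k]²≡4k[1+k]+1 k

  heron : IsHeron a a c
  heron = subst (λ x → IsHeron x x c) (consecutive-pythagorean {p} {q} p²≡2q+1)
            (isoscelesHeron {p} {q} z<s (1+2k<2k[1+k] N))

  m⊥c : Coprime m c
  m⊥c = hypotenuse-coprime {p} {r} p²≡2q+1

  isPrimitive : IsPrimitive a a c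
  isPrimitive = coprime⇒isPrimitive (coprime-*ˡ m⊥c m⊥c)

  square : IsSquare a
  square = m , refl

  N<perimeter : a + a + c > N
  N<perimeter = begin-strict
    N          <⟨ n<1+n N ⟩
    k          ≤⟨ m≤m+n k (k + 0) ⟩
    2 * k      <⟨ n<1+n (2 * k) ⟩
    p          ≤⟨ m≤n*m p 4 ⟩
    4 * p      ≤⟨ m≤m*n (4 * p) q ⟩
    c          ≤⟨ m≤n+m c (a + a) ⟩
    a + a + c  ∎
    where open ≤-Reasoning
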